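{- Let $G$ be a finite group and $\psi:G\to G$ an abelian map. Let $N_\psi=\{\eta_\psi(h): h\in G\}\subseteq\mathrm{Perm}(G)$, where $\eta_\psi(h)=\lambda(h\psi(h)^{ -1})\rho(\psi(h)^{ -1})$. Then for every $g\in G$ there exists an abelian map $\psi'$ on $G$ such that $\rho(g)N_\psi\rho(g)^{ -1}=N_{\psi'}$.
   Context: An abelian map on $G$ is a group endomorphism $G\to G$ with abelian image. $\mathrm{Perm}(G)$ is the group of permutations of the set $G$; $\lambda(g)[x]=gx$ and $\rho(g)[x]=xg^{ -1}$. For each abelian map $\psi$, $N_\psi$ is a regular subgroup of $\mathrm{Perm}(G)$ normalized by $\lambda(G)$. -}

module Defs where

open import Level using (Level; _⊔_)
open import Algebra.Bundles using (Group)
open import Data.Nat using (ℕ)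
open import Data.Fin using (Fin)
open import Data.Product using (Σ; ∃; _×_; _,_)
open import Function.Base using (_∘_)

IsFinite : ∀ {c ℓ} → Group c ℓ → Set (c ⊔ ℓ)
IsFinite G = Σ ℕ λ n → Σ (Fin n → Carrier) λ e → ∀ x → ∃ λ i → e i ≈ x
  where open Group G

module _ {c ℓ} (G : Group c ℓ) where
  open Group G

  IsEndomorphism : (Carrier → Carrier) → Set (c ⊔ ℓ)
  IsEndomorphism ψ =
    (∀ {x y} → x ≈ y → ψ x ≈ ψ y) × (∀ x y → ψ (x ∙ y) ≈ ψ x ∙ ψ y)

  IsAbelianMap : (Carrier → Carrier) → Set (c ⊔ ℓ)
  IsAbelianMap ψ = IsEndomorphism ψ × (∀ x y → ψ x ∙ ψ y ≈ ψ y ∙ ψ x)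

  -- Maps on the underlying set of G (permutations of G are among these);
  -- equality of maps is pointwise.
  Map : Set c
  Map = Carrier → Carrier

  _≐_ : Map → Map → Set (c ⊔ ℓ)
  σ ≐ τ = ∀ x → σ x ≈ τ x

  λ̂ : Carrier → Map
  λ̂ g x = g ∙ x

  ρ̂ : Carrier → Map
  ρ̂ g x = x ∙ g ⁻¹

  η : (Carrier → Carrier) → Carrier → Map
  η ψ h = λ̂ (h ∙ ψ h ⁻¹) ∘ ρ̂ (ψ h ⁻¹)

  N : (Carrier → Carrier) → Map → Set (c ⊔ ℓ)
  N ψ σ = ∃ λ h → σ ≐ η ψ h

  -- ρ(g) S ρ(g)⁻¹ ; note ρ(g)⁻¹ = ρ(g⁻¹) in Perm(G)
  conjρ : Carrier → (Map → Set (c ⊔ ℓ)) → Map → Set (c ⊔ ℓ)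
  conjρ g S σ = ∃ λ τ → S τ × (σ ≐ (ρ̂ g ∘ τ ∘ ρ̂ (g ⁻¹)))

  _≋_ : (Map → Set (c ⊔ ℓ)) → (Map → Set (c ⊔ ℓ)) → Set (c ⊔ ℓ)
  S ≋ T = ∀ σ → (S σ → T σ) × (T σ → S σ)

{-# OPTIONS --safe #-}
-- Conjugation by ρ(g) fixes the λ-part of η_ψ(h) = λ(h ψ(h)⁻¹) ρ(ψ(h)⁻¹) and conjugates its
-- ρ-part by g, so it lands in N_ψ′ for the abelian map ψ′ = (g · g⁻¹) ∘ ψ as soon as the parameter
-- h is traded for some k with ψ′(k) = g ψ(h) g⁻¹ and k ψ′(k)⁻¹ = h ψ(h)⁻¹. Since ψ has abelian
-- image it is invariant under conjugation, which makes k = h ψ(h)⁻¹ ψ′(h) work, with inverse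
-- k ↦ k ψ′(k)⁻¹ ψ(k).
module Submission where

open import Defs
open import Algebra.Bundles using (Group)
open import Data.Product using (Σ; _×_; _,_; proj₁; proj₂)
open import Function.Base using (_∘_)
import Algebra.Properties.Group as GroupProperties
import Relation.Binary.Reasoning.Setoid as SetoidReasoning

module _ {c ℓ} (G : Group c ℓ) where
  open Group G
  open GroupProperties G
    using (inverseˡ-unique; ⁻¹-involutive; ∙-cancelˡ; //-rightDividesˡ; //-rightDividesʳ)
  open SetoidReasoning setoid

  conj : Carrier → Carrier → Carrier
  conj g y = (g ∙ y) ∙ g ⁻¹

  module Endomorphism {ψ : Carrier → Carrier} (endo : IsEndomorphism G ψ) where

    ψ-cong : ∀ {x y} → x ≈ y → ψ x ≈ ψ y
    ψ-cong = proj₁ endo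

    ψ-homo : ∀ x y → ψ (x ∙ y) ≈ ψ x ∙ ψ y
    ψ-homo = proj₂ endo

    ε-homo : ψ ε ≈ ε
    ε-homo = ∙-cancelˡ (ψ ε) (ψ ε) ε (begin
      ψ ε ∙ ψ ε  ≈⟨ ψ-homo ε ε ⟨
      ψ (ε ∙ ε)  ≈⟨ ψ-cong (identityˡ ε) ⟩
      ψ ε        ≈⟨ identityʳ (ψ ε) ⟨
      ψ ε ∙ ε    ∎)

    ⁻¹-homo : ∀ x → ψ (x ⁻¹) ≈ ψ x ⁻¹
    ⁻¹-homo x = inverseˡ-unique (ψ (x ⁻¹)) (ψ x) (begin
      ψ (x ⁻¹) ∙ ψ x  ≈⟨ ψ-homo (x ⁻¹) x ⟨
      ψ (x ⁻¹ ∙ x)    ≈⟨ ψ-cong (inverseˡ x) ⟩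
      ψ ε             ≈⟨ ε-homo ⟩
      ε               ∎)

    ψy≈ψz⇒ψ[h∙y⁻¹∙z]≈ψh : ∀ h {y z} → ψ y ≈ ψ z → ψ ((h ∙ y ⁻¹) ∙ z) ≈ ψ h
    ψy≈ψz⇒ψ[h∙y⁻¹∙z]≈ψh h {y} {z} ψy≈ψz = begin
      ψ ((h ∙ y ⁻¹) ∙ z)        ≈⟨ ψ-homo (h ∙ y ⁻¹) z ⟩
      ψ (h ∙ y ⁻¹) ∙ ψ z        ≈⟨ ∙-congʳ (ψ-homo h (y ⁻¹)) ⟩
      (ψ h ∙ ψ (y ⁻¹)) ∙ ψ z    ≈⟨ ∙-cong (∙-congˡ (⁻¹-homo y)) (sym ψy≈ψz) ⟩
      (ψ h ∙ ψ y ⁻¹) ∙ ψ y      ≈⟨ //-rightDividesˡ (ψ y) (ψ h) ⟩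
      ψ h                       ∎

  conj-isEndomorphism : ∀ g → IsEndomorphism G (conj g)
  conj-isEndomorphism g = (λ x≈y → ∙-congʳ (∙-congˡ x≈y)) , λ x y → begin
    (g ∙ (x ∙ y)) ∙ g ⁻¹                 ≈⟨ ∙-congʳ (assoc g x y) ⟨
    ((g ∙ x) ∙ y) ∙ g ⁻¹                 ≈⟨ ∙-congʳ (∙-congʳ (//-rightDividesˡ g (g ∙ x))) ⟨
    (((g ∙ x) ∙ g ⁻¹) ∙ g ∙ y) ∙ g ⁻¹    ≈⟨ ∙-congʳ (assoc (conj g x) g y) ⟩
    (conj g x ∙ (g ∙ y)) ∙ g ⁻¹          ≈⟨ assoc (conj g x) (g ∙ y) (g ⁻¹) ⟩
    conj g x ∙ conj g y                  ∎

  ∘-isAbelianMap : ∀ {f ψ} → IsEndomorphism G f → IsAbelianMap G ψ → IsAbelianMap G (f ∘ ψ)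
  ∘-isAbelianMap {f} {ψ} (f-cong , f-homo) ((ψ-cong , ψ-homo) , ψ-comm) =
    ((f-cong ∘ ψ-cong) , λ x y → trans (f-cong (ψ-homo x y)) (f-homo (ψ x) (ψ y))) ,
    λ x y → begin
      f (ψ x) ∙ f (ψ y)  ≈⟨ f-homo (ψ x) (ψ y) ⟨
      f (ψ x ∙ ψ y)      ≈⟨ f-cong (ψ-comm x y) ⟩
      f (ψ y ∙ ψ x)      ≈⟨ f-homo (ψ y) (ψ x) ⟩
      f (ψ y) ∙ f (ψ x)  ∎

  abelianMap-conj-invariant : ∀ {ψ} → IsAbelianMap G ψ → ∀ g y → ψ (conj g y) ≈ ψ y
  abelianMap-conj-invariant {ψ} (endo , ψ-comm) g y = begin
    ψ ((g ∙ y) ∙ g ⁻¹)        ≈⟨ ψ-homo (g ∙ y) (g ⁻¹) ⟩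
    ψ (g ∙ y) ∙ ψ (g ⁻¹)      ≈⟨ ∙-congʳ (trans (ψ-homo g y) (ψ-comm g y)) ⟩
    (ψ y ∙ ψ g) ∙ ψ (g ⁻¹)    ≈⟨ ∙-congˡ (⁻¹-homo g) ⟩
    (ψ y ∙ ψ g) ∙ ψ g ⁻¹      ≈⟨ //-rightDividesʳ (ψ g) (ψ y) ⟩
    ψ y                       ∎
    where open Endomorphism endo

  λ̂∘ρ̂-cong : ∀ {a a′ b b′} → a ≈ a′ → b ≈ b′ → _≐_ G (λ̂ G a ∘ ρ̂ G b) (λ̂ G a′ ∘ ρ̂ G b′)
  λ̂∘ρ̂-cong a≈a′ b≈b′ x = ∙-cong a≈a′ (∙-congˡ (⁻¹-cong b≈b′))

  ρ̂-conj-λ̂∘ρ̂ : ∀ g a b →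
    _≐_ G (ρ̂ G g ∘ (λ̂ G a ∘ ρ̂ G b) ∘ ρ̂ G (g ⁻¹)) (λ̂ G a ∘ ρ̂ G (conj g b))
  ρ̂-conj-λ̂∘ρ̂ g a b x = begin
    (a ∙ ((x ∙ g ⁻¹ ⁻¹) ∙ b ⁻¹)) ∙ g ⁻¹   ≈⟨ ∙-congʳ (∙-congˡ (∙-congʳ (∙-congˡ (⁻¹-involutive g)))) ⟩
    (a ∙ ((x ∙ g) ∙ b ⁻¹)) ∙ g ⁻¹         ≈⟨ assoc a ((x ∙ g) ∙ b ⁻¹) (g ⁻¹) ⟩
    a ∙ (((x ∙ g) ∙ b ⁻¹) ∙ g ⁻¹)         ≈⟨ ∙-congˡ (∙-congʳ (assoc x g (b ⁻¹))) ⟩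
    a ∙ ((x ∙ (g ∙ b ⁻¹)) ∙ g ⁻¹)         ≈⟨ ∙-congˡ (assoc x (g ∙ b ⁻¹) (g ⁻¹)) ⟩
    a ∙ (x ∙ conj g (b ⁻¹))               ≈⟨ ∙-congˡ (∙-congˡ (⁻¹-homo b)) ⟩
    a ∙ (x ∙ conj g b ⁻¹)                 ∎
    where open Endomorphism (conj-isEndomorphism g)

  module ConjugateAbelianMap {ψ : Carrier → Carrier} (abelian : IsAbelianMap G ψ) (g : Carrier) where
    open Endomorphism (proj₁ abelian)

    ψ′ : Carrier → Carrier
    ψ′ = conj g ∘ ψ

    ψ′-isAbelianMap : IsAbelianMap G ψ′
    ψ′-isAbelianMap = ∘-isAbelianMap (conj-isEndomorphism g) abelian

    ψ∘ψ′≈ψ∘ψ : ∀ h → ψ (ψ′ h) ≈ ψ (ψ h)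
    ψ∘ψ′≈ψ∘ψ h = abelianMap-conj-invariant abelian g (ψ h)

    Paired : Carrier → Carrier → Set ℓ
    Paired h k = ψ k ≈ ψ h × k ∙ ψ′ k ⁻¹ ≈ h ∙ ψ h ⁻¹

    ψ′-factors-through-ψ : ∀ {h k} → ψ k ≈ ψ h → ψ′ k ≈ ψ′ h
    ψ′-factors-through-ψ = proj₁ (conj-isEndomorphism g)

    paired-from : ∀ h → Paired h ((h ∙ ψ h ⁻¹) ∙ ψ′ h)
    paired-from h = ψk≈ψh , (begin
        k ∙ ψ′ k ⁻¹   ≈⟨ ∙-congˡ (⁻¹-cong (ψ′-factors-through-ψ ψk≈ψh)) ⟩
        k ∙ ψ′ h ⁻¹   ≈⟨ //-rightDividesʳ (ψ′ h) (h ∙ ψ h ⁻¹) ⟩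
        h ∙ ψ h ⁻¹    ∎)
      where
      k = (h ∙ ψ h ⁻¹) ∙ ψ′ h
      ψk≈ψh : ψ k ≈ ψ h
      ψk≈ψh = ψy≈ψz⇒ψ[h∙y⁻¹∙z]≈ψh h (sym (ψ∘ψ′≈ψ∘ψ h))

    paired-to : ∀ k → Paired ((k ∙ ψ′ k ⁻¹) ∙ ψ k) k
    paired-to k = sym ψh≈ψk , (begin
        k ∙ ψ′ k ⁻¹   ≈⟨ //-rightDividesʳ (ψ k) (k ∙ ψ′ k ⁻¹) ⟨
        h ∙ ψ k ⁻¹    ≈⟨ ∙-congˡ (⁻¹-cong ψh≈ψk) ⟨
        h ∙ ψ h ⁻¹    ∎)
      where
      h = (k ∙ ψ′ k ⁻¹) ∙ ψ k
      ψh≈ψk : ψ h ≈ ψ k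
      ψh≈ψk = ψy≈ψz⇒ψ[h∙y⁻¹∙z]≈ψh k (ψ∘ψ′≈ψ∘ψ k)

    paired⇒ρ̂-conj-η≐η : ∀ {h k} → Paired h k →
      _≐_ G (ρ̂ G g ∘ η G ψ h ∘ ρ̂ G (g ⁻¹)) (η G ψ′ k)
    paired⇒ρ̂-conj-η≐η {h} (ψk≈ψh , k∙ψ′k⁻¹≈h∙ψh⁻¹) x = trans
      (ρ̂-conj-λ̂∘ρ̂ g (h ∙ ψ h ⁻¹) (ψ h ⁻¹) x)
      (λ̂∘ρ̂-cong (sym k∙ψ′k⁻¹≈h∙ψh⁻¹)
        (trans (conj-⁻¹-homo (ψ h)) (⁻¹-cong (sym (ψ′-factors-through-ψ ψk≈ψh)))) x)
      where open Endomorphism (conj-isEndomorphism g) renaming (⁻¹-homo to conj-⁻¹-homo)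

proposition6p4 : ∀ {c ℓ} (G : Group c ℓ) → IsFinite G →
    (ψ : Group.Carrier G → Group.Carrier G) → IsAbelianMap G ψ →
    (g : Group.Carrier G) →
    Σ (Group.Carrier G → Group.Carrier G) λ ψ′ → IsAbelianMap G ψ′ × _≋_ G (conjρ G g (N G ψ)) (N G ψ′)
proposition6p4 G _ ψ abelian g = ψ′ , ψ′-isAbelianMap , λ σ → forward σ , backward σ
  where
  open Group G
  open ConjugateAbelianMap G abelian g

  forward : ∀ σ → conjρ G g (N G ψ) σ → N G ψ′ σ
  forward σ (τ , (h , τ≐ηh) , σ≐conjτ) = _ , λ x →
    trans (σ≐conjτ x) (trans (∙-congʳ (τ≐ηh _)) (paired⇒ρ̂-conj-η≐η (paired-from h) x))

  backward : ∀ σ → N G ψ′ σ → conjρ G g (N G ψ) σ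
  backward σ (k , σ≐ηk) = η G ψ _ , (_ , λ _ → refl) , λ x →
    trans (σ≐ηk x) (sym (paired⇒ρ̂-conj-η≐η (paired-to k) x))
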